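{- Let $s,u\ge 0$ be integers, let $B\subset[n]$ be a set with $|B|\ge s$, and let $\mathcal{A}\subset 2^{[n]}$ be a family with $|\mathcal{A}|>2^s\binom{n}{\le u}$. Then there exists some $A\in\mathcal{A}$ such that $|A\cup B|\ge s+u+1$.
   Context: $[n]=\{1,\dots,n\}$ and $\binom{n}{\le u}=\sum_{j=0}^{u}\binom{n}{j}$. -}

module Defs where

open import Data.Nat using (ℕ; zero; suc; _+_)
open import Data.Nat.Combinatorics using (_C_)

binom≤ : ℕ → ℕ → ℕ
binom≤ n zero    = n C 0
binom≤ n (suc u) = binom≤ n u + n C (suc u)

module Submission where

-- Let smallUnions B k list all sets A ⊆ [n] with |A ∪ B| ≤ k,
-- generated by recursion on the characteristic vector of B, and let
-- count B k be its length.
-- (1) Completeness: every A with |A ∪ B| ≤ k occurs in smallUnions B k.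
-- (2) Counting: if s ≤ |B| then count B (s + u) ≤ 2^s · binom≤ n u.  An element of B doubles the count, since it may or may
--     not lie in A, and is paid for by a factor 2 of 2^s (or, once s is used
--     up, by Pascal's rule for binom≤); an element outside B either stays
--     outside A or costs one unit of the budget k, which matches Pascal's rule
--     binom≤ (n+1) (u+1) = binom≤ n (u+1) + binom≤ n u.
-- (3) Pigeonhole: a duplicate-free list contained in another list is no longer.
-- If every member of 𝒜 had |A ∪ B| ≤ s + u, then 𝒜 ⊆ smallUnions B (s + u)
-- by (1), and (2), (3) would give |𝒜| ≤ 2^s · binom≤ n u.  The condition is
-- decidable, so a member of 𝒜 with |A ∪ B| ≥ s + u + 1 can be found.

open import Defs
open import Data.Nat using (ℕ; _+_; _*_; _^_; _≤_; _<_)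
open import Data.Fin.Subset using (Subset; ∣_∣; _∪_)
open import Data.List using (List; length)
open import Data.List.Relation.Unary.Unique.Propositional using (Unique)
open import Data.List.Membership.Propositional using (_∈_)
open import Data.Product using (∃-syntax; _×_)

open import Data.Nat using (zero; suc; z≤n; s≤s; _≤?_)
open import Data.Nat.Properties
open import Data.Nat.Combinatorics using (_C_; nCk+nC[k+1]≡[n+1]C[k+1])
open import Data.Nat.Solver using (module +-*-Solver)
open import Data.Bool using (true; false)
open import Data.Vec using ([]; _∷_)
open import Data.Fin using (Fin; zero; suc)
open import Data.Fin.Properties using (injective⇒≤)
open import Data.List using ([]; _∷_; _++_; map; lookup)
open import Data.List.Properties using (length-++; length-map)
open import Data.List.Relation.Unary.Any as Any using (any?)
open import Data.List.Relation.Unary.Any.Properties using (lookup-index)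
open import Data.List.Relation.Unary.All as All using ()
open import Data.List.Relation.Unary.AllPairs using (_∷_)
open import Data.List.Relation.Binary.Subset.Propositional using (_⊆_)
open import Data.List.Membership.Propositional using (find; lose)
open import Data.List.Membership.Propositional.Properties using (∈-map⁺; ∈-++⁺ˡ; ∈-++⁺ʳ; ∈-lookup)
open import Function.Definitions using (Injective)
open import Relation.Nullary using (¬_; yes; no; contradiction)
open import Relation.Binary.PropositionalEquality

module _ {a} {A : Set a} where

  unique⇒lookup-injective : {xs : List A} → Unique xs → Injective _≡_ _≡_ (lookup xs)
  unique⇒lookup-injective (_ ∷ _)   {zero}  {zero}  _  = refl
  unique⇒lookup-injective (x≢ ∷ _)  {zero}  {suc j} eq = contradiction eq (All.lookup x≢ (∈-lookup j))
  unique⇒lookup-injective (x≢ ∷ _)  {suc i} {zero}  eq = contradiction (sym eq) (All.lookup x≢ (∈-lookup i))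
  unique⇒lookup-injective (_ ∷ xs!) {suc i} {suc j} eq = cong suc (unique⇒lookup-injective xs! eq)

  -- A duplicate-free list contained in ys is at most as long as ys: sending
  -- each position of xs to a position of its entry in ys is injective.
  unique-⊆⇒length-≤ : {xs ys : List A} → Unique xs → xs ⊆ ys → length xs ≤ length ys
  unique-⊆⇒length-≤ {xs} {ys} xs! xs⊆ys = injective⇒≤ position-injective
    where
    position : Fin (length xs) → Fin (length ys)
    position i = Any.index (xs⊆ys (∈-lookup i))

    located : ∀ i → lookup xs i ≡ lookup ys (position i)
    located i = lookup-index (xs⊆ys (∈-lookup i))

    position-injective : Injective _≡_ _≡_ position
    position-injective {i} {j} eq = unique⇒lookup-injective xs!
      (trans (located i) (trans (cong (lookup ys) eq) (sym (located j))))

-- Pascal's rule for partial sums of binomial coefficients; it drives the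
-- count of step (2) whenever an element outside B is added.
binom≤-pascal : ∀ n u → binom≤ (suc n) (suc u) ≡ binom≤ n (suc u) + binom≤ n u
binom≤-pascal n zero = begin
  1 + suc n C 1        ≡⟨ cong (1 +_) (sym (nCk+nC[k+1]≡[n+1]C[k+1] n 0)) ⟩
  1 + (1 + n C 1)      ≡⟨ +-comm 1 (1 + n C 1) ⟩
  (1 + n C 1) + 1      ∎
  where open ≡-Reasoning
binom≤-pascal n (suc u) = begin
  binom≤ (suc n) (suc u) + suc n C suc (suc u)
    ≡⟨ cong₂ _+_ (binom≤-pascal n u) (sym (nCk+nC[k+1]≡[n+1]C[k+1] n (suc u))) ⟩
  (a + b) + a + (b + c)
    ≡⟨ regroup a b c ⟩
  (a + b + c) + (a + b) ∎
  where
  open ≡-Reasoning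
  a = binom≤ n u
  b = n C suc u
  c = n C suc (suc u)
  regroup : ∀ a b c → (a + b) + a + (b + c) ≡ (a + b + c) + (a + b)
  regroup = solve 3 (λ a b c → (a :+ b) :+ a :+ (b :+ c) := (a :+ b :+ c) :+ (a :+ b)) refl
    where open +-*-Solver

binom≤-positive : ∀ n u → 1 ≤ binom≤ n u
binom≤-positive n zero    = ≤-refl
binom≤-positive n (suc u) = ≤-trans (binom≤-positive n u) (m≤m+n _ _)

binom≤-mono : ∀ n u → binom≤ n u ≤ binom≤ (suc n) u
binom≤-mono n zero    = ≤-refl
binom≤-mono n (suc u) = subst (binom≤ n (suc u) ≤_) (sym (binom≤-pascal n u)) (m≤m+n _ _)

binom≤-double : ∀ n u → 2 * binom≤ n u ≤ binom≤ (suc n) (suc u)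
binom≤-double n u = begin
  2 * binom≤ n u                   ≡⟨ cong (binom≤ n u +_) (+-identityʳ (binom≤ n u)) ⟩
  binom≤ n u + binom≤ n u          ≤⟨ +-monoˡ-≤ (binom≤ n u) (m≤m+n (binom≤ n u) (n C suc u)) ⟩
  binom≤ n (suc u) + binom≤ n u    ≡⟨ sym (binom≤-pascal n u) ⟩
  binom≤ (suc n) (suc u)           ∎
  where open ≤-Reasoning

-- smallUnions B k lists every A ⊆ [n] with |A ∪ B| ≤ k.  A coordinate in B
-- uses one unit of the budget whatever A does there; a coordinate outside B
-- uses one unit exactly when it lies in A.
smallUnions : ∀ {n} → Subset n → ℕ → List (Subset n)
smallUnions []          k       = [] ∷ []
smallUnions (true ∷ B)  zero    = []
smallUnions (true ∷ B)  (suc k) = map (true ∷_) (smallUnions B k) ++ map (false ∷_) (smallUnions B k)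
smallUnions (false ∷ B) zero    = map (false ∷_) (smallUnions B zero)
smallUnions (false ∷ B) (suc k) = map (false ∷_) (smallUnions B (suc k)) ++ map (true ∷_) (smallUnions B k)

smallUnions-complete : ∀ {n} (A B : Subset n) k → ∣ A ∪ B ∣ ≤ k → A ∈ smallUnions B k
smallUnions-complete []          []          k       _          = Any.here refl
smallUnions-complete (true ∷ A)  (true ∷ B)  (suc k) (s≤s small) =
  ∈-++⁺ˡ (∈-map⁺ _ (smallUnions-complete A B k small))
smallUnions-complete (false ∷ A) (true ∷ B)  (suc k) (s≤s small) =
  ∈-++⁺ʳ _ (∈-map⁺ _ (smallUnions-complete A B k small))
smallUnions-complete (false ∷ A) (false ∷ B) zero    small       =
  ∈-map⁺ _ (smallUnions-complete A B zero small)
smallUnions-complete (false ∷ A) (false ∷ B) (suc k) small       =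
  ∈-++⁺ˡ (∈-map⁺ _ (smallUnions-complete A B (suc k) small))
smallUnions-complete (true ∷ A)  (false ∷ B) (suc k) (s≤s small) =
  ∈-++⁺ʳ _ (∈-map⁺ _ (smallUnions-complete A B k small))

count : ∀ {n} → Subset n → ℕ → ℕ
count B k = length (smallUnions B k)

count-in : ∀ {n} (B : Subset n) k → count (true ∷ B) (suc k) ≡ 2 * count B k
count-in B k = begin
  count (true ∷ B) (suc k)                                              ≡⟨ length-++ (map (true ∷_) (smallUnions B k)) ⟩
  length (map (true ∷_) (smallUnions B k)) + length (map (false ∷_) (smallUnions B k))
    ≡⟨ cong₂ _+_ (length-map (true ∷_) (smallUnions B k)) (length-map (false ∷_) (smallUnions B k)) ⟩
  count B k + count B k                                                 ≡⟨ cong (count B k +_) (sym (+-identityʳ (count B k))) ⟩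
  2 * count B k                                                         ∎
  where open ≡-Reasoning

count-out : ∀ {n} (B : Subset n) k → count (false ∷ B) (suc k) ≡ count B (suc k) + count B k
count-out B k = trans (length-++ (map (false ∷_) (smallUnions B (suc k))))
  (cong₂ _+_ (length-map (false ∷_) (smallUnions B (suc k))) (length-map (true ∷_) (smallUnions B k)))

count-out₀ : ∀ {n} (B : Subset n) → count (false ∷ B) zero ≡ count B zero
count-out₀ B = length-map (false ∷_) (smallUnions B zero)

count-vanishes : ∀ {n} (B : Subset n) k → k < ∣ B ∣ → count B k ≡ 0
count-vanishes (true ∷ B)  zero    _          = refl
count-vanishes (true ∷ B)  (suc k) (s≤s k<B) = trans (count-in B k) (cong (2 *_) (count-vanishes B k k<B))
count-vanishes (false ∷ B) zero    0<B        = trans (count-out₀ B) (count-vanishes B zero 0<B)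
count-vanishes (false ∷ B) (suc k) k<B        = begin
  count (false ∷ B) (suc k)        ≡⟨ count-out B k ⟩
  count B (suc k) + count B k      ≡⟨ cong₂ _+_ (count-vanishes B (suc k) k<B) (count-vanishes B k (<-trans (n<1+n k) k<B)) ⟩
  0                                ∎
  where open ≡-Reasoning

-- The case u = 0 of the counting bound: for s ≤ |B| at most 2^s sets A have
-- |A ∪ B| ≤ s (they are the subsets of B, and only when s = |B|).
count-exact : ∀ {n} (B : Subset n) s → s ≤ ∣ B ∣ → count B s ≤ 2 ^ s
count-exact []          zero    _         = ≤-refl
count-exact (true ∷ B)  zero    _         = z≤n
count-exact (true ∷ B)  (suc s) (s≤s s≤B) = ≤-trans (≤-reflexive (count-in B s)) (*-monoʳ-≤ 2 (count-exact B s s≤B))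
count-exact (false ∷ B) zero    _         = ≤-trans (≤-reflexive (count-out₀ B)) (count-exact B zero z≤n)
count-exact (false ∷ B) (suc s) s<B       = begin
  count (false ∷ B) (suc s)        ≡⟨ count-out B s ⟩
  count B (suc s) + count B s      ≡⟨ cong (count B (suc s) +_) (count-vanishes B s s<B) ⟩
  count B (suc s) + 0              ≡⟨ +-identityʳ (count B (suc s)) ⟩
  count B (suc s)                  ≤⟨ count-exact B (suc s) s<B ⟩
  2 ^ suc s                        ∎
  where open ≤-Reasoning

count-bound : ∀ {n} (B : Subset n) s u → s ≤ ∣ B ∣ → count B (s + u) ≤ 2 ^ s * binom≤ n u
count-bound B s zero s≤B =
  subst₂ (λ k m → count B k ≤ m) (sym (+-identityʳ s)) (sym (*-identityʳ (2 ^ s))) (count-exact B s s≤B)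
count-bound {n} [] zero (suc u) _ = ≤-trans (binom≤-positive n (suc u)) (≤-reflexive (sym (*-identityˡ _)))
count-bound {suc n} (true ∷ B) zero (suc u) _ = begin
  count (true ∷ B) (suc u)         ≡⟨ count-in B u ⟩
  2 * count B u                    ≤⟨ *-monoʳ-≤ 2 (≤-trans (count-bound B zero u z≤n) (≤-reflexive (*-identityˡ _))) ⟩
  2 * binom≤ n u                   ≤⟨ binom≤-double n u ⟩
  binom≤ (suc n) (suc u)           ≡⟨ sym (*-identityˡ _) ⟩
  1 * binom≤ (suc n) (suc u)       ∎
  where open ≤-Reasoning
count-bound {suc n} (true ∷ B) (suc s) (suc u) (s≤s s≤B) = begin
  count (true ∷ B) (suc s + suc u)       ≡⟨ count-in B (s + suc u) ⟩
  2 * count B (s + suc u)                ≤⟨ *-monoʳ-≤ 2 (count-bound B s (suc u) s≤B) ⟩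
  2 * (2 ^ s * binom≤ n (suc u))         ≡⟨ sym (*-assoc 2 (2 ^ s) _) ⟩
  2 ^ suc s * binom≤ n (suc u)           ≤⟨ *-monoʳ-≤ (2 ^ suc s) (binom≤-mono n (suc u)) ⟩
  2 ^ suc s * binom≤ (suc n) (suc u)     ∎
  where open ≤-Reasoning
count-bound {suc n} (false ∷ B) s (suc u) s≤B = begin
  count (false ∷ B) (s + suc u)                  ≡⟨ cong (count (false ∷ B)) (+-suc s u) ⟩
  count (false ∷ B) (suc (s + u))                ≡⟨ count-out B (s + u) ⟩
  count B (suc (s + u)) + count B (s + u)        ≡⟨ cong (_+ count B (s + u)) (cong (count B) (sym (+-suc s u))) ⟩
  count B (s + suc u) + count B (s + u)          ≤⟨ +-mono-≤ (count-bound B s (suc u) s≤B) (count-bound B s u s≤B) ⟩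
  2 ^ s * binom≤ n (suc u) + 2 ^ s * binom≤ n u  ≡⟨ sym (*-distribˡ-+ (2 ^ s) _ _) ⟩
  2 ^ s * (binom≤ n (suc u) + binom≤ n u)        ≡⟨ cong (2 ^ s *_) (sym (binom≤-pascal n u)) ⟩
  2 ^ s * binom≤ (suc n) (suc u)                 ∎
  where open ≤-Reasoning

not-large⇒small : ∀ k m → ¬ (k + 1 ≤ m) → m ≤ k
not-large⇒small k m not-large = m<1+n⇒m≤n (subst (m <_) (+-comm k 1) (≰⇒> not-large))

lemma8 : (n s u : ℕ) (B : Subset n) → s ≤ ∣ B ∣ →
    (𝒜 : List (Subset n)) → Unique 𝒜 →
    2 ^ s * binom≤ n u < length 𝒜 →
    ∃[ A ] (A ∈ 𝒜 × s + u + 1 ≤ ∣ A ∪ B ∣)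
lemma8 n s u B s≤B 𝒜 𝒜! 𝒜-large with any? (λ A → s + u + 1 ≤? ∣ A ∪ B ∣) 𝒜
... | yes found = find found
... | no none    = contradiction 𝒜-large (≤⇒≯ 𝒜-small)
  where
  𝒜⊆smallUnions : 𝒜 ⊆ smallUnions B (s + u)
  𝒜⊆smallUnions {A} A∈𝒜 =
    smallUnions-complete A B (s + u) (not-large⇒small (s + u) ∣ A ∪ B ∣ (λ large → none (lose A∈𝒜 large)))

  𝒜-small : length 𝒜 ≤ 2 ^ s * binom≤ n u
  𝒜-small = ≤-trans (unique-⊆⇒length-≤ 𝒜! 𝒜⊆smallUnions) (count-bound B s u s≤B)
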